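{- For any formula $\phi$ in the language of $\mathbb{MPT}$, any classical substitution $\sigma$ and any team $X$: $X\models\sigma(\phi)\iff X_\sigma\models\phi$, where for a valuation $s$ the valuation $s_\sigma$ is defined by $s_\sigma(i)=1$ if $\{s\}\models\sigma(p_i)$ and $s_\sigma(i)=0$ otherwise, and $X_\sigma=\{s_\sigma:s\in X\}$.
   Context: Variables $p_i$ ($i\in\mathbb N$); a valuation is $s:\mathbb N\to\{0,1\}$; a team is a set of valuations. Classical formulas: $\alpha::=p_i\mid\neg p_i\mid\bot\mid\alpha\wedge\alpha\mid\alpha\otimes\alpha$. Formulas of $\mathbb{MPT}$: $\phi::=p_i\mid\neg p_i\mid\neg\alpha\mid\top\mid\mathrm{NE}\mid\bot\mid\vec\alpha\perp\vec\beta\mid{=}(\vec\alpha,\beta)\mid\vec\alpha\subseteq\vec\beta\mid\phi\wedge\phi\mid\phi\otimes\phi\mid\phi\circledast\phi\mid\phi\vee\phi$, where $\alpha,\beta$ are classical formulas and $\vec\alpha=\alpha_1\dots\alpha_k$, $\vec\beta$ finite sequences of classical formulas (of equal length for $\subseteq$). For sequences $\vec\alpha,\vec\beta$ of length $k$ write $s\sim_{(\vec\alpha,\vec\beta)}s'$ iff for all $i\le k$ ($\{s\}\models\alpha_i\iff\{s'\}\models\beta_i$), and $\sim_{\vec\alpha}:=\sim_{(\vec\alpha,\vec\alpha)}$. Semantics: $X\models p_i$ iff $s(i)=1$ for all $s\in X$; $X\models\neg p_i$ iff $s(i)=0$ for all $s\in X$; $X\models\neg\alpha$ iff $\{s\}\not\models\alpha$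 for all $s\in X$; $X\models\top$ always; $X\models\bot$ iff $X=\emptyset$; $X\models\mathrm{NE}$ iff $X\ne\emptyset$; $X\models\vec\alpha\perp\vec\beta$ iff for all $s,s'\in X$ there is $s''\in X$ with $s\sim_{\vec\alpha}s''$ and $s'\sim_{\vec\beta}s''$; $X\models{=}(\vec\alpha,\beta)$ iff for all $s,s'\in X$, $s\sim_{\vec\alpha}s'$ implies $s\sim_\beta s'$; $X\models\vec\alpha\subseteq\vec\beta$ iff for all $s\in X$ there is $s'\in X$ with $s\sim_{(\vec\alpha,\vec\beta)}s'$; $X\models\phi\wedge\psi$ iff both; $X\models\phi\otimes\psi$ iff $X=Y\cup Z$ with $Y\models\phi$, $Z\models\psi$; $X\models\phi\circledast\psi$ iff $X=\emptyset$ or $X=Y\cup Z$ with $Y,Z$ nonempty, $Y\models\phi$, $Z\models\psi$; $X\models\phi\vee\psi$ iff $X\models\phi$ or $X\models\psi$. A classical substitution is a map $\sigma$ assigning to each variable $p_i$ a classical formula $\sigma(p_i)$, extended to all $\mathbb{MPT}$-formulas by commuting with all connectives and atoms ($\sigma(\neg\alpha)=\neg\sigma(\alpha)$, $\sigma$ fixes $\mathrm{NE},\bot,\top$, acts componentwise on the arguments of $\perp$, ${=}(\cdot)$, $\subseteq$, and commutes with $\wedge,\otimes,\circledast,\vee$). -}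

module Defs where

open import Data.Nat using (ℕ)
open import Data.Bool using (Bool; true; false)
open import Data.Vec using (Vec; []; _∷_)
open import Data.Product using (Σ; _×_; _,_; ∃)
open import Data.Sum using (_⊎_)
open import Data.Unit.Polymorphic using (⊤)
open import Relation.Nullary using (¬_)
open import Relation.Binary.PropositionalEquality using (_≡_)
open import Function.Bundles using (_⇔_)
open import Level using (Level; _⊔_; Lift) renaming (suc to lsuc; zero to lzero)

-- valuations s : ℕ → {0,1}  (true = 1, false = 0)
Valuation : Set
Valuation = ℕ → Bool

Team : (ℓ : Level) → Set (lsuc ℓ)
Team ℓ = Valuation → Set ℓ

_≐_∪_ : ∀ {ℓ} → Team ℓ → Team ℓ → Team ℓ → Set ℓ
X ≐ Y ∪ Z = ∀ s → (X s ⇔ (Y s ⊎ Z s))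

IsEmpty : ∀ {ℓ} → Team ℓ → Set ℓ
IsEmpty X = ∀ s → ¬ X s

NonEmpty : ∀ {ℓ} → Team ℓ → Set ℓ
NonEmpty X = ∃ λ s → X s

-- the singleton team {s}; valuations are identified extensionally
singleton : Valuation → Team lzero
singleton s t = ∀ i → t i ≡ s i

-- classical formulas  α ::= p_i | ¬α | ⊥ | α ∧ α | α ⊗ α
-- (¬ is applied to arbitrary classical formulas, as needed for
--  σ(¬p_i) = ¬σ(p_i); the atom ¬p_i is  c¬ (cvar i))
data CF : Set where
  cvar : ℕ → CF
  c¬   : CF → CF
  c⊥   : CF
  _c∧_ : CF → CF → CF
  _c⊗_ : CF → CF → CF

_⊨c_ : ∀ {ℓ} → Team ℓ → CF → Set (lsuc ℓ)
_⊨c_ {ℓ} X (cvar i) = Lift (lsuc ℓ) (∀ s → X s → s i ≡ true)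
_⊨c_ {ℓ} X (c¬ α)   = Lift (lsuc ℓ) (∀ s → X s → ¬ (singleton s ⊨c α))
_⊨c_ {ℓ} X c⊥       = Lift (lsuc ℓ) (IsEmpty X)
X ⊨c (α c∧ β) = (X ⊨c α) × (X ⊨c β)
_⊨c_ {ℓ} X (α c⊗ β) =
  Σ (Team ℓ) λ Y → Σ (Team ℓ) λ Z → Lift (lsuc ℓ) (X ≐ Y ∪ Z) × (Y ⊨c α) × (Z ⊨c β)

_⊨₁_ : Valuation → CF → Set₁
s ⊨₁ α = singleton s ⊨c α

Sim : ∀ {k} → Vec CF k → Vec CF k → Valuation → Valuation → Set₁
Sim []       []       s s' = ⊤
Sim (α ∷ as) (β ∷ bs) s s' = ((s ⊨₁ α) ⇔ (s' ⊨₁ β)) × Sim as bs s s'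

Sim₁ : ∀ {k} → Vec CF k → Valuation → Valuation → Set₁
Sim₁ as = Sim as as

data MPT : Set where
  var   : ℕ → MPT
  nvar  : ℕ → MPT
  neg   : CF → MPT
  top   : MPT
  NE    : MPT
  bot   : MPT
  indep : ∀ {k m} → Vec CF k → Vec CF m → MPT
  dep   : ∀ {k} → Vec CF k → CF → MPT
  incl  : ∀ {k} → Vec CF k → Vec CF k → MPT
  _∧_   : MPT → MPT → MPT
  _⊗_   : MPT → MPT → MPT
  _⊛_   : MPT → MPT → MPT
  _∨_   : MPT → MPT → MPT

_⊨_ : ∀ {ℓ} → Team ℓ → MPT → Set (lsuc (ℓ ⊔ lsuc lzero))
_⊨_ {ℓ} X (var i)  = Lift (lsuc (ℓ ⊔ lsuc lzero)) (∀ s → X s → s i ≡ true)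
_⊨_ {ℓ} X (nvar i) = Lift (lsuc (ℓ ⊔ lsuc lzero)) (∀ s → X s → s i ≡ false)
_⊨_ {ℓ} X (neg α)  = Lift (lsuc (ℓ ⊔ lsuc lzero)) (∀ s → X s → ¬ (s ⊨₁ α))
_⊨_ {ℓ} X top      = ⊤
_⊨_ {ℓ} X NE       = Lift (lsuc (ℓ ⊔ lsuc lzero)) (NonEmpty X)
_⊨_ {ℓ} X bot      = Lift (lsuc (ℓ ⊔ lsuc lzero)) (IsEmpty X)
_⊨_ {ℓ} X (indep as bs) =
  Lift (lsuc (ℓ ⊔ lsuc lzero)) (∀ s s' → X s → X s' → Σ Valuation λ s'' → X s'' × Sim₁ as s s'' × Sim₁ bs s' s'')
_⊨_ {ℓ} X (dep as β) =
  Lift (lsuc (ℓ ⊔ lsuc lzero)) (∀ s s' → X s → X s' → Sim₁ as s s' → Sim₁ (β ∷ []) s s')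
_⊨_ {ℓ} X (incl as bs) =
  Lift (lsuc (ℓ ⊔ lsuc lzero)) (∀ s → X s → Σ Valuation λ s' → X s' × Sim as bs s s')
X ⊨ (φ ∧ ψ) = (X ⊨ φ) × (X ⊨ ψ)
_⊨_ {ℓ} X (φ ⊗ ψ) =
  Σ (Team ℓ) λ Y → Σ (Team ℓ) λ Z → Lift (lsuc (ℓ ⊔ lsuc lzero)) (X ≐ Y ∪ Z) × (Y ⊨ φ) × (Z ⊨ ψ)
_⊨_ {ℓ} X (φ ⊛ ψ) =
  Lift (lsuc (ℓ ⊔ lsuc lzero)) (IsEmpty X) ⊎
  (Σ (Team ℓ) λ Y → Σ (Team ℓ) λ Z →
     Lift (lsuc (ℓ ⊔ lsuc lzero)) ((X ≐ Y ∪ Z) × NonEmpty Y × NonEmpty Z) × (Y ⊨ φ) × (Z ⊨ ψ))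
X ⊨ (φ ∨ ψ) = (X ⊨ φ) ⊎ (X ⊨ ψ)

Subst : Set
Subst = ℕ → CF

substC : Subst → CF → CF
substC σ (cvar i)  = σ i
substC σ (c¬ α)    = c¬ (substC σ α)
substC σ c⊥        = c⊥
substC σ (α c∧ β)  = substC σ α c∧ substC σ β
substC σ (α c⊗ β)  = substC σ α c⊗ substC σ β

substV : ∀ {k} → Subst → Vec CF k → Vec CF k
substV σ []       = []
substV σ (α ∷ as) = substC σ α ∷ substV σ as

embed : CF → MPT
embed (cvar i) = var i
embed (c¬ α)   = neg α
embed c⊥       = bot
embed (α c∧ β) = embed α ∧ embed β
embed (α c⊗ β) = embed α ⊗ embed β

subst : Subst → MPT → MPT
subst σ (var i)       = embed (σ i)
subst σ (nvar i)      = neg (σ i)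
subst σ (neg α)       = neg (substC σ α)
subst σ top           = top
subst σ NE            = NE
subst σ bot           = bot
subst σ (indep as bs) = indep (substV σ as) (substV σ bs)
subst σ (dep as β)    = dep (substV σ as) (substC σ β)
subst σ (incl as bs)  = incl (substV σ as) (substV σ bs)
subst σ (φ ∧ ψ)       = subst σ φ ∧ subst σ ψ
subst σ (φ ⊗ ψ)       = subst σ φ ⊗ subst σ ψ
subst σ (φ ⊛ ψ)       = subst σ φ ⊛ subst σ ψ
subst σ (φ ∨ ψ)       = subst σ φ ∨ subst σ ψ

IsSσ : Subst → Valuation → Valuation → Set₁
IsSσ σ s t = ∀ i → (t i ≡ true) ⇔ (s ⊨₁ σ i)

Tσ : Subst → Team (lsuc lzero) → Team (lsuc lzero)
Tσ σ X t = Σ Valuation λ s → X s × IsSσ σ s t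

-- Classical formulas are flat: a team satisfies α iff each member s does, i.e. iff the truth value
-- ⟦ α ⟧ s is true. As ⟦ σ(α) ⟧ s = ⟦ α ⟧ s_σ, the relations ∼ read off σ(α⃗), σ(β⃗) at s, s' are
-- those read off α⃗, β⃗ at s_σ, s'_σ, which settles every atom. For the induction over ⊗ and ⊛ the
-- claim is proved for any two teams X, Y whose members correspond under s ↦ s_σ in both directions:
-- a splitting of either team then induces a splitting of the other into corresponding parts.
module Submission where

open import Defs
open import Data.Bool using (Bool; true; false; T; not) renaming (_∧_ to _∧ᵇ_; _∨_ to _∨ᵇ_)
open import Data.Bool.Properties using (T-≡; T-not-≡; T-∧; T-∨; ⇔→≡)
open import Data.Product using (Σ; _×_; _,_; proj₁; proj₂)
open import Data.Product.Function.NonDependent.Propositional using (_×-⇔_)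
open import Data.Sum using (_⊎_; inj₁; inj₂; [_,_])
open import Data.Sum.Function.Propositional using (_⊎-⇔_)
import Data.Sum as Sum
open import Data.Vec using (Vec; []; _∷_)
open import Function using (flip; id)
open import Function.Bundles using (_⇔_; mk⇔; Equivalence)
import Function.Properties.Equivalence as ⇔
open import Function.Related.TypeIsomorphisms using (¬-cong-⇔)
open import Level using (Level; _⊔_; Lift; lift; lower) renaming (suc to lsuc; zero to lzero)
open import Relation.Nullary using (¬_)
open import Relation.Binary.PropositionalEquality using (_≡_; _≗_; refl; cong; cong₂)
import Relation.Binary.PropositionalEquality as ≡

open Equivalence

private
  variable
    a b ℓ p q : Level
    A A' B B' : Set a

Team₁ : Set₂
Team₁ = Team (lsuc lzero)

Lift-⇔ : Lift a A ⇔ A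
Lift-⇔ = mk⇔ lower lift

Lift-cong : A ⇔ B → Lift a A ⇔ Lift b B
Lift-cong e = ⇔.trans Lift-⇔ (⇔.trans e (⇔.sym Lift-⇔))

⇔-cong : A ⇔ A' → B ⇔ B' → (A ⇔ B) ⇔ (A' ⇔ B')
⇔-cong e f = mk⇔ (λ g → ⇔.trans (⇔.sym e) (⇔.trans g f)) (λ g → ⇔.trans e (⇔.trans g (⇔.sym f)))

T-cong : {x y : Bool} → x ≡ y → T x ⇔ T y
T-cong refl = ⇔.refl

¬T⇔T-not : ∀ {x} → (¬ T x) ⇔ T (not x)
¬T⇔T-not {true}  = mk⇔ (λ f → f _) (λ ())
¬T⇔T-not {false} = mk⇔ _ (λ _ ())

All : Team ℓ → (Valuation → Set p) → Set (ℓ ⊔ p)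
All X P = ∀ s → X s → P s

module _ {X : Team ℓ} {P : Valuation → Set p} {Q : Valuation → Set q} where

  All-cong : (∀ s → P s ⇔ Q s) → All X P ⇔ All X Q
  All-cong e = mk⇔ (λ h s x → to (e s) (h s x)) (λ h s x → from (e s) (h s x))

  All-× : (All X P × All X Q) ⇔ All X (λ s → P s × Q s)
  All-× = mk⇔ (λ (f , g) s x → f s x , g s x)
              (λ h → (λ s x → proj₁ (h s x)) , (λ s x → proj₂ (h s x)))

module _ {X : Team ℓ} {P Q : Valuation → Set} {F G : Team ℓ → Set b} where

  split⇔All-⊎ : (∀ {Y} → F Y ⇔ All Y P) → (∀ {Z} → G Z ⇔ All Z Q) →
    (Σ (Team ℓ) λ Y → Σ (Team ℓ) λ Z → Lift b (X ≐ Y ∪ Z) × F Y × G Z) ⇔ All X (λ s → P s ⊎ Q s)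
  split⇔All-⊎ F⇔ G⇔ = mk⇔
    (λ (Y , Z , lift eq , fY , gZ) s x → Sum.map (to F⇔ fY s) (to G⇔ gZ s) (to (eq s) x))
    (λ h → (λ s → X s × P s) , (λ s → X s × Q s) ,
           lift (λ s → mk⇔ (λ x → Sum.map (x ,_) (x ,_) (h s x)) [ proj₁ , proj₁ ]) ,
           from F⇔ (λ _ → proj₂) , from G⇔ (λ _ → proj₂))

⟦_⟧ : CF → Valuation → Bool
⟦ cvar i ⟧  s = s i
⟦ c¬ α ⟧    s = not (⟦ α ⟧ s)
⟦ c⊥ ⟧      s = false
⟦ α c∧ β ⟧  s = ⟦ α ⟧ s ∧ᵇ ⟦ β ⟧ s
⟦ α c⊗ β ⟧  s = ⟦ α ⟧ s ∨ᵇ ⟦ β ⟧ s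

⟦⟧-cong : ∀ α {s t} → s ≗ t → ⟦ α ⟧ s ≡ ⟦ α ⟧ t
⟦⟧-cong (cvar i)  e = e i
⟦⟧-cong (c¬ α)    e = cong not (⟦⟧-cong α e)
⟦⟧-cong c⊥        e = refl
⟦⟧-cong (α c∧ β)  e = cong₂ _∧ᵇ_ (⟦⟧-cong α e) (⟦⟧-cong β e)
⟦⟧-cong (α c⊗ β)  e = cong₂ _∨ᵇ_ (⟦⟧-cong α e) (⟦⟧-cong β e)

All-singleton : ∀ α {s} → All (singleton s) (λ t → T (⟦ α ⟧ t)) ⇔ T (⟦ α ⟧ s)
All-singleton α = mk⇔ (λ h → h _ (λ _ → refl)) (λ h t t≗s → from (T-cong (⟦⟧-cong α t≗s)) h)

⊨c-flat : ∀ α {X : Team ℓ} → X ⊨c α ⇔ All X (λ s → T (⟦ α ⟧ s))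
⊨c-flat (cvar i)  = ⇔.trans Lift-⇔ (All-cong λ _ → ⇔.sym T-≡)
⊨c-flat (c¬ α)    = ⇔.trans Lift-⇔ (All-cong λ _ →
  ⇔.trans (¬-cong-⇔ (⇔.trans (⊨c-flat α) (All-singleton α))) ¬T⇔T-not)
⊨c-flat c⊥        = Lift-⇔
⊨c-flat (α c∧ β)  = ⇔.trans (⊨c-flat α ×-⇔ ⊨c-flat β) (⇔.trans All-× (All-cong λ _ → ⇔.sym T-∧))
⊨c-flat (α c⊗ β)  =
  ⇔.trans (split⇔All-⊎ (⊨c-flat α) (⊨c-flat β)) (All-cong λ _ → ⇔.sym T-∨)

⊨₁-eval : ∀ α {s} → s ⊨₁ α ⇔ T (⟦ α ⟧ s)
⊨₁-eval α = ⇔.trans (⊨c-flat α) (All-singleton α)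

embed-flat : ∀ α {X : Team ℓ} → X ⊨ embed α ⇔ All X (λ s → T (⟦ α ⟧ s))
embed-flat (cvar i)  = ⇔.trans Lift-⇔ (All-cong λ _ → ⇔.sym T-≡)
embed-flat (c¬ α)    = ⇔.trans Lift-⇔ (All-cong λ _ → ⇔.trans (¬-cong-⇔ (⊨₁-eval α)) ¬T⇔T-not)
embed-flat c⊥        = Lift-⇔
embed-flat (α c∧ β)  = ⇔.trans (embed-flat α ×-⇔ embed-flat β) (⇔.trans All-× (All-cong λ _ → ⇔.sym T-∧))
embed-flat (α c⊗ β)  =
  ⇔.trans (split⇔All-⊎ (embed-flat α) (embed-flat β)) (All-cong λ _ → ⇔.sym T-∨)

substVal : Subst → Valuation → Valuation
substVal σ s i = ⟦ σ i ⟧ s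

⟦substC⟧ : ∀ σ α {s} → ⟦ substC σ α ⟧ s ≡ ⟦ α ⟧ (substVal σ s)
⟦substC⟧ σ (cvar i)  = refl
⟦substC⟧ σ (c¬ α)    = cong not (⟦substC⟧ σ α)
⟦substC⟧ σ c⊥        = refl
⟦substC⟧ σ (α c∧ β)  = cong₂ _∧ᵇ_ (⟦substC⟧ σ α) (⟦substC⟧ σ β)
⟦substC⟧ σ (α c⊗ β)  = cong₂ _∨ᵇ_ (⟦substC⟧ σ α) (⟦substC⟧ σ β)

module _ (σ : Subst) where

  IsSσ-substVal : ∀ s → IsSσ σ s (substVal σ s)
  IsSσ-substVal s i = ⇔.trans (⇔.sym T-≡) (⇔.sym (⊨₁-eval (σ i)))

  IsSσ⇒substVal≗ : ∀ {s t} → IsSσ σ s t → substVal σ s ≗ t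
  IsSσ⇒substVal≗ {s} I i = ⇔→≡ (⇔.trans (IsSσ-substVal s i) (⇔.sym (I i)))

  ⟦⟧-transfer : ∀ {s t} → IsSσ σ s t → ∀ α → ⟦ substC σ α ⟧ s ≡ ⟦ α ⟧ t
  ⟦⟧-transfer {s} {t} I α = begin
    ⟦ substC σ α ⟧ s     ≡⟨ ⟦substC⟧ σ α ⟩
    ⟦ α ⟧ (substVal σ s) ≡⟨ ⟦⟧-cong α (IsSσ⇒substVal≗ I) ⟩
    ⟦ α ⟧ t              ∎
    where open ≡.≡-Reasoning

  ⊨₁-transfer : ∀ {s t} → IsSσ σ s t → ∀ α → (s ⊨₁ substC σ α) ⇔ (t ⊨₁ α)
  ⊨₁-transfer I α =
    ⇔.trans (⊨₁-eval (substC σ α)) (⇔.trans (T-cong (⟦⟧-transfer I α)) (⇔.sym (⊨₁-eval α)))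

  Sim-transfer : ∀ {k} (as bs : Vec CF k) {s s' t t'} → IsSσ σ s t → IsSσ σ s' t' →
    Sim (substV σ as) (substV σ bs) s s' ⇔ Sim as bs t t'
  Sim-transfer []       []       I I' = ⇔.refl
  Sim-transfer (α ∷ as) (β ∷ bs) I I' =
    ⇔-cong (⊨₁-transfer I α) (⊨₁-transfer I' β) ×-⇔ Sim-transfer as bs I I'

record Correspondence (R : Valuation → Valuation → Set₁) (X Y : Team₁) : Set₁ where
  field
    forth : ∀ {s} → X s → Σ Valuation λ t → Y t × R s t
    back  : ∀ {t} → Y t → Σ Valuation λ s → X s × R s t

open Correspondence

swap : ∀ {R X Y} → Correspondence R X Y → Correspondence (flip R) Y X
swap C = record { forth = back C ; back = forth C }

Invariant₂ : (R : Valuation → Valuation → Set₁) (P P' : Valuation → Valuation → Set₁) → Set₁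
Invariant₂ R P P' = ∀ {s s' t t'} → R s t → R s' t' → P s s' ⇔ P' t t'

Indep : Team₁ → (Valuation → Valuation → Set₁) → (Valuation → Valuation → Set₁) → Set₁
Indep X P Q = ∀ s s' → X s → X s' → Σ Valuation λ s'' → X s'' × P s s'' × Q s' s''

Dep : Team₁ → (Valuation → Valuation → Set₁) → (Valuation → Valuation → Set₁) → Set₁
Dep X P Q = ∀ s s' → X s → X s' → P s s' → Q s s'

Incl : Team₁ → (Valuation → Valuation → Set₁) → Set₁
Incl X P = ∀ s → X s → Σ Valuation λ s' → X s' × P s s'

module _ {R : Valuation → Valuation → Set₁} {X Y : Team₁} (C : Correspondence R X Y) where

  All-transfer : {P Q : Valuation → Set p} → (∀ {s t} → R s t → P s ⇔ Q t) → All X P ⇔ All Y Q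
  All-transfer P⇔Q = mk⇔
    (λ h t y → let s , x , r = back C y in to (P⇔Q r) (h s x))
    (λ h s x → let t , y , r = forth C x in from (P⇔Q r) (h t y))

  NonEmpty-transfer : NonEmpty X ⇔ NonEmpty Y
  NonEmpty-transfer = mk⇔
    (λ (s , x) → let t , y , _ = forth C x in t , y)
    (λ (t , y) → let s , x , _ = back C y in s , x)

  IsEmpty-transfer : IsEmpty X ⇔ IsEmpty Y
  IsEmpty-transfer = mk⇔
    (λ e t y → let s , x , _ = back C y in e s x)
    (λ e s x → let t , y , _ = forth C x in e t y)

  Indep-preserved : ∀ {P Q P' Q'} → Invariant₂ R P P' → Invariant₂ R Q Q' → Indep X P Q → Indep Y P' Q'
  Indep-preserved P⇔ Q⇔ h t t' y y' =
    let s , x , r = back C y ; s' , x' , r' = back C y'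
        s'' , x'' , p , q = h s s' x x'
        t'' , y'' , r'' = forth C x''
    in t'' , y'' , to (P⇔ r r'') p , to (Q⇔ r' r'') q

  Dep-preserved : ∀ {P Q P' Q'} → Invariant₂ R P P' → Invariant₂ R Q Q' → Dep X P Q → Dep Y P' Q'
  Dep-preserved P⇔ Q⇔ h t t' y y' p =
    let s , x , r = back C y ; s' , x' , r' = back C y'
    in to (Q⇔ r r') (h s s' x x' (from (P⇔ r r') p))

  Incl-preserved : ∀ {P P'} → Invariant₂ R P P' → Incl X P → Incl Y P'
  Incl-preserved P⇔ h t y =
    let s , x , r = back C y
        s' , x' , p = h s x
        t' , y' , r' = forth C x'
    in t' , y' , to (P⇔ r r') p

  restrict : ∀ {X'} → (∀ {s} → X' s → X s) →
    Correspondence R X' (λ t → Y t × Σ Valuation λ s → X' s × R s t)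
  restrict X'⊆X = record
    { forth = λ x' → let t , y , r = forth C (X'⊆X x') in t , (y , _ , x' , r) , r
    ; back  = λ (_ , s , x' , r) → s , x' , r
    }

  ∪-preserved : ∀ {X₁ X₂} → X ≐ X₁ ∪ X₂ →
    Y ≐ (λ t → Y t × Σ Valuation λ s → X₁ s × R s t) ∪ (λ t → Y t × Σ Valuation λ s → X₂ s × R s t)
  ∪-preserved eq t = mk⇔
    (λ y → let s , x , r = back C y
           in Sum.map (λ x₁ → y , s , x₁ , r) (λ x₂ → y , s , x₂ , r) (to (eq s) x))
    [ proj₁ , proj₁ ]

module _ {R : Valuation → Valuation → Set₁} {X Y : Team₁} (C : Correspondence R X Y) where

  Indep-transfer : ∀ {P Q P' Q'} → Invariant₂ R P P' → Invariant₂ R Q Q' → Indep X P Q ⇔ Indep Y P' Q'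
  Indep-transfer P⇔ Q⇔ =
    mk⇔ (Indep-preserved C P⇔ Q⇔)
        (Indep-preserved (swap C) (λ r r' → ⇔.sym (P⇔ r r')) (λ r r' → ⇔.sym (Q⇔ r r')))

  Dep-transfer : ∀ {P Q P' Q'} → Invariant₂ R P P' → Invariant₂ R Q Q' → Dep X P Q ⇔ Dep Y P' Q'
  Dep-transfer P⇔ Q⇔ =
    mk⇔ (Dep-preserved C P⇔ Q⇔)
        (Dep-preserved (swap C) (λ r r' → ⇔.sym (P⇔ r r')) (λ r r' → ⇔.sym (Q⇔ r r')))

  Incl-transfer : ∀ {P P'} → Invariant₂ R P P' → Incl X P ⇔ Incl Y P'
  Incl-transfer P⇔ = mk⇔ (Incl-preserved C P⇔) (Incl-preserved (swap C) (λ r r' → ⇔.sym (P⇔ r r')))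

  ⊗-preserved : ∀ {φ ψ φ' ψ'} →
    (∀ {X' Y'} → Correspondence R X' Y' → X' ⊨ φ → Y' ⊨ φ') →
    (∀ {X' Y'} → Correspondence R X' Y' → X' ⊨ ψ → Y' ⊨ ψ') →
    X ⊨ (φ ⊗ ψ) → Y ⊨ (φ' ⊗ ψ')
  ⊗-preserved φ⇒ ψ⇒ (X₁ , X₂ , lift eq , h₁ , h₂) =
    _ , _ , lift (∪-preserved C eq) ,
    φ⇒ (restrict C (λ x₁ → from (eq _) (inj₁ x₁))) h₁ ,
    ψ⇒ (restrict C (λ x₂ → from (eq _) (inj₂ x₂))) h₂

  ⊛-preserved : ∀ {φ ψ φ' ψ'} →
    (∀ {X' Y'} → Correspondence R X' Y' → X' ⊨ φ → Y' ⊨ φ') →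
    (∀ {X' Y'} → Correspondence R X' Y' → X' ⊨ ψ → Y' ⊨ ψ') →
    X ⊨ (φ ⊛ ψ) → Y ⊨ (φ' ⊛ ψ')
  ⊛-preserved φ⇒ ψ⇒ (inj₁ (lift e)) = inj₁ (lift (to (IsEmpty-transfer C) e))
  ⊛-preserved φ⇒ ψ⇒ (inj₂ (X₁ , X₂ , lift (eq , ne₁ , ne₂) , h₁ , h₂)) =
    inj₂ (_ , _ ,
          lift (∪-preserved C eq , to (NonEmpty-transfer C₁) ne₁ , to (NonEmpty-transfer C₂) ne₂) ,
          φ⇒ C₁ h₁ , ψ⇒ C₂ h₂)
    where
    C₁ = restrict C (λ x₁ → from (eq _) (inj₁ x₁))
    C₂ = restrict C (λ x₂ → from (eq _) (inj₂ x₂))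

module _ (σ : Subst) where

  embed-transfer : ∀ α {X Y} → Correspondence (IsSσ σ) X Y → X ⊨ embed (substC σ α) ⇔ Y ⊨ embed α
  embed-transfer α C =
    ⇔.trans (embed-flat (substC σ α))
      (⇔.trans (All-transfer C (λ I → T-cong (⟦⟧-transfer σ I α))) (⇔.sym (embed-flat α)))

  nvar-flat : ∀ i {X : Team₁} → X ⊨ embed (c¬ (cvar i)) ⇔ X ⊨ nvar i
  nvar-flat i = ⇔.trans (embed-flat (c¬ (cvar i))) (⇔.trans (All-cong λ _ → T-not-≡) (⇔.sym Lift-⇔))

  sat-transfer : ∀ φ {X Y} → Correspondence (IsSσ σ) X Y → X ⊨ subst σ φ ⇔ Y ⊨ φ
  sat-transfer (var i)       C = embed-transfer (cvar i) C
  sat-transfer (nvar i)      C = ⇔.trans (embed-transfer (c¬ (cvar i)) C) (nvar-flat i)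
  sat-transfer (neg α)       C = embed-transfer (c¬ α) C
  sat-transfer top           C = ⇔.refl
  sat-transfer NE            C = Lift-cong (NonEmpty-transfer C)
  sat-transfer bot           C = Lift-cong (IsEmpty-transfer C)
  sat-transfer (indep as bs) C = Lift-cong (Indep-transfer C (Sim-transfer σ as as) (Sim-transfer σ bs bs))
  sat-transfer (dep as β)    C =
    Lift-cong (Dep-transfer C (Sim-transfer σ as as) (Sim-transfer σ (β ∷ []) (β ∷ [])))
  sat-transfer (incl as bs)  C = Lift-cong (Incl-transfer C (Sim-transfer σ as bs))
  sat-transfer (φ ∧ ψ)       C = sat-transfer φ C ×-⇔ sat-transfer ψ C
  sat-transfer (φ ⊗ ψ)       C = mk⇔
    (⊗-preserved C (λ C' → to (sat-transfer φ C')) (λ C' → to (sat-transfer ψ C')))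
    (⊗-preserved (swap C) (λ C' → from (sat-transfer φ (swap C')))
                            (λ C' → from (sat-transfer ψ (swap C'))))
  sat-transfer (φ ⊛ ψ)       C = mk⇔
    (⊛-preserved C (λ C' → to (sat-transfer φ C')) (λ C' → to (sat-transfer ψ C')))
    (⊛-preserved (swap C) (λ C' → from (sat-transfer φ (swap C')))
                            (λ C' → from (sat-transfer ψ (swap C'))))
  sat-transfer (φ ∨ ψ)       C = sat-transfer φ C ⊎-⇔ sat-transfer ψ C

  Tσ-correspondence : ∀ X → Correspondence (IsSσ σ) X (Tσ σ X)
  Tσ-correspondence X = record
    { forth = λ {s} x → substVal σ s , (s , x , IsSσ-substVal σ s) , IsSσ-substVal σ s
    ; back  = id
    }

lemma4p4 : (φ : MPT) (σ : Subst) (X : Team (lsuc lzero)) →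
    (X ⊨ subst σ φ) ⇔ (Tσ σ X ⊨ φ)
lemma4p4 φ σ X = sat-transfer σ φ (Tσ-correspondence σ X)
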